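{- Suppose every term of $\lambda^{Sym}_{Prop}$ is strongly normalizing with respect to $\to_{\beta\pi}$. Then every term of $\lambda^{Sym}_{Prop}$ is strongly normalizing with respect to the full reduction $\to$.
   Context: The calculus $\lambda^{Sym}_{Prop}$: fix atomic types $a,b,\dots$ and negated atomic types $a^\bot,\dots$. m-types: $A::=\alpha\mid\alpha^\bot\mid A\wedge A\mid A\vee A$; types: $C::=A\mid\bot$. Negation of m-types: $(\alpha)^\bot=\alpha^\bot$, $(\alpha^\bot)^\bot=\alpha$, $(A\wedge B)^\bot=A^\bot\vee B^\bot$, $(A\vee B)^\bot=A^\bot\wedge B^\bot$. Contexts assign m-types to variables. Typing: $\Gamma,x:A\vdash x:A$; from $\Gamma\vdash P_1:A_1$, $\Gamma\vdash P_2:A_2$ infer $\Gamma\vdash\langle P_1,P_2\rangle:A_1\wedge A_2$; from $\Gamma\vdash P_i:A_i$ infer $\Gamma\vdash\sigma_i(P_i):A_1\vee A_2$; from $\Gamma,x:A\vdash P:\bot$ infer $\Gamma\vdash\lambda xP:A^\bot$; from $\Gamma\vdash P_1:A^\bot$, $\Gamma\vdash P_2:A$ infer $\Gamma\vdash(P_1\star P_2):\bot$. Terms are the typable ones. Rules: ($\beta$) $(\lambda xP\star Q)\to P[x:=Q]$; ($\beta^\bot$) $(Q\star\lambda xP)\to P[x:=Q]$; ($\eta$) $\lambda x(P\star x)\to P$ if $x\notin Fv(P)$; ($\eta^\bot$) $\lambda x(x\star P)\to P$ if $x\notin Fv(P)$; ($\pi$) $(\langle P_1,P_2\rangle\star\sigma_i(Q))\to(P_i\star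 Q)$; ($\pi^\bot$) $(\sigma_i(Q)\star\langle P_1,P_2\rangle)\to(Q\star P_i)$; ($Triv$) $E[P]\to P$ whenever $E[-]\neq[-]$ is a one-hole context such that $E[P]$ has type $\bot$, $P$ has type $\bot$, and $E[-]$ binds no free variable of $P$. $\to$ is the compatible closure of the union of all these rules; $\to_{\beta\pi}$ is the compatible closure of $\beta,\beta^\bot,\pi,\pi^\bot$ only. -}

module Defs where

open import Data.Nat using (ℕ)
open import Data.Bool using (Bool; true; false)
open import Data.List using (List; []; _∷_; _++_)
open import Relation.Binary.PropositionalEquality using (_≡_; refl; sym; cong₂; subst)
open import Induction.WellFounded using (Acc)

-- Types of λ^Sym_Prop.  Atomic types are indexed by ℕ (a, b, …);
-- `natom a` is the negated atomic type a^⊥.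

infixr 6 _∧_
infixr 5 _∨_

data MTy : Set where
  atom  : ℕ → MTy
  natom : ℕ → MTy
  _∧_   : MTy → MTy → MTy
  _∨_   : MTy → MTy → MTy

data Ty : Set where
  ⌜_⌝ : MTy → Ty
  bot : Ty

neg : MTy → MTy
neg (atom a)  = natom a
neg (natom a) = atom a
neg (A ∧ B)   = neg A ∨ neg B
neg (A ∨ B)   = neg A ∧ neg B

negneg : ∀ A → neg (neg A) ≡ A
negneg (atom a)  = refl
negneg (natom a) = refl
negneg (A ∧ B)   = cong₂ _∧_ (negneg A) (negneg B)
negneg (A ∨ B)   = cong₂ _∨_ (negneg A) (negneg B)

Cx : Set
Cx = List MTy

infix 4 _∋_
data _∋_ : Cx → MTy → Set where
  here  : ∀ {Γ A} → (A ∷ Γ) ∋ A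
  there : ∀ {Γ A B} → Γ ∋ A → (B ∷ Γ) ∋ A

infix 7 _⋆_
data Tm (Γ : Cx) : Ty → Set where
  var   : ∀ {A} → Γ ∋ A → Tm Γ ⌜ A ⌝
  ⟨_,_⟩ : ∀ {A B} → Tm Γ ⌜ A ⌝ → Tm Γ ⌜ B ⌝ → Tm Γ ⌜ A ∧ B ⌝
  σ₁    : ∀ {A B} → Tm Γ ⌜ A ⌝ → Tm Γ ⌜ A ∨ B ⌝
  σ₂    : ∀ {A B} → Tm Γ ⌜ B ⌝ → Tm Γ ⌜ A ∨ B ⌝
  ƛ     : ∀ {A} → Tm (A ∷ Γ) bot → Tm Γ ⌜ neg A ⌝
  _⋆_   : ∀ {A} → Tm Γ ⌜ neg A ⌝ → Tm Γ ⌜ A ⌝ → Tm Γ bot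

Ren : Cx → Cx → Set
Ren Γ Δ = ∀ {A} → Γ ∋ A → Δ ∋ A

ext : ∀ {Γ Δ B} → Ren Γ Δ → Ren (B ∷ Γ) (B ∷ Δ)
ext ρ here      = here
ext ρ (there x) = there (ρ x)

rename : ∀ {Γ Δ C} → Ren Γ Δ → Tm Γ C → Tm Δ C
rename ρ (var x)     = var (ρ x)
rename ρ ⟨ P , Q ⟩   = ⟨ rename ρ P , rename ρ Q ⟩
rename ρ (σ₁ P)      = σ₁ (rename ρ P)
rename ρ (σ₂ P)      = σ₂ (rename ρ P)
rename ρ (ƛ P)       = ƛ (rename (ext ρ) P)
rename ρ (P ⋆ Q)     = rename ρ P ⋆ rename ρ Q

Sub : Cx → Cx → Set
Sub Γ Δ = ∀ {A} → Γ ∋ A → Tm Δ ⌜ A ⌝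

exts : ∀ {Γ Δ B} → Sub Γ Δ → Sub (B ∷ Γ) (B ∷ Δ)
exts σ here      = var here
exts σ (there x) = rename there (σ x)

sub : ∀ {Γ Δ C} → Sub Γ Δ → Tm Γ C → Tm Δ C
sub σ (var x)   = σ x
sub σ ⟨ P , Q ⟩ = ⟨ sub σ P , sub σ Q ⟩
sub σ (σ₁ P)    = σ₁ (sub σ P)
sub σ (σ₂ P)    = σ₂ (sub σ P)
sub σ (ƛ P)     = ƛ (sub (exts σ) P)
sub σ (P ⋆ Q)   = sub σ P ⋆ sub σ Q

single : ∀ {Γ A} → Tm Γ ⌜ A ⌝ → Sub (A ∷ Γ) Γ
single Q here      = Q
single Q (there x) = var x

_[_] : ∀ {Γ A C} → Tm (A ∷ Γ) C → Tm Γ ⌜ A ⌝ → Tm Γ C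
P [ Q ] = sub (single Q) P

wk* : ∀ {Γ} (Bs : Cx) → Ren Γ (Bs ++ Γ)
wk* []       x = x
wk* (B ∷ Bs) x = there (wk* Bs x)

castTm : ∀ {Γ A B} → A ≡ B → Tm Γ ⌜ A ⌝ → Tm Γ ⌜ B ⌝
castTm {Γ} e P = subst (λ X → Tm Γ ⌜ X ⌝) e P

-- One-hole contexts.  Hole Γ C Δ D : a context E[-] with E[P] : C in Γ
-- whenever P : D in Δ (Δ = Γ extended by the binders of E crossed by the hole).

data Hole : Cx → Ty → Cx → Ty → Set where
  []    : ∀ {Γ C} → Hole Γ C Γ C
  pairL : ∀ {Γ Δ D A B} → Hole Γ ⌜ A ⌝ Δ D → Tm Γ ⌜ B ⌝ → Hole Γ ⌜ A ∧ B ⌝ Δ D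
  pairR : ∀ {Γ Δ D A B} → Tm Γ ⌜ A ⌝ → Hole Γ ⌜ B ⌝ Δ D → Hole Γ ⌜ A ∧ B ⌝ Δ D
  σ₁H   : ∀ {Γ Δ D A B} → Hole Γ ⌜ A ⌝ Δ D → Hole Γ ⌜ A ∨ B ⌝ Δ D
  σ₂H   : ∀ {Γ Δ D A B} → Hole Γ ⌜ B ⌝ Δ D → Hole Γ ⌜ A ∨ B ⌝ Δ D
  ƛH    : ∀ {Γ Δ D A} → Hole (A ∷ Γ) bot Δ D → Hole Γ ⌜ neg A ⌝ Δ D
  starL : ∀ {Γ Δ D A} → Hole Γ ⌜ neg A ⌝ Δ D → Tm Γ ⌜ A ⌝ → Hole Γ bot Δ D
  starR : ∀ {Γ Δ D A} → Tm Γ ⌜ neg A ⌝ → Hole Γ ⌜ A ⌝ Δ D → Hole Γ bot Δ D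

plug : ∀ {Γ C Δ D} → Hole Γ C Δ D → Tm Δ D → Tm Γ C
plug []          P = P
plug (pairL E Q) P = ⟨ plug E P , Q ⟩
plug (pairR Q E) P = ⟨ Q , plug E P ⟩
plug (σ₁H E)     P = σ₁ (plug E P)
plug (σ₂H E)     P = σ₂ (plug E P)
plug (ƛH E)      P = ƛ (plug E P)
plug (starL E Q) P = plug E P ⋆ Q
plug (starR Q E) P = Q ⋆ plug E P

isEmpty : ∀ {Γ C Δ D} → Hole Γ C Δ D → Bool
isEmpty [] = true
isEmpty _  = false

infix 4 _↦βπ_ _↦_

data _↦βπ_ {Γ : Cx} : ∀ {C} → Tm Γ C → Tm Γ C → Set where
  β   : ∀ {A} (P : Tm (A ∷ Γ) bot) (Q : Tm Γ ⌜ A ⌝) →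
        _⋆_ {A = A} (ƛ P) Q ↦βπ P [ Q ]
  β⊥  : ∀ {A} (Q : Tm Γ ⌜ neg (neg A) ⌝) (P : Tm (A ∷ Γ) bot) →
        _⋆_ {A = neg A} Q (ƛ P) ↦βπ P [ castTm (negneg A) Q ]
  π₁  : ∀ {A B} (P₁ : Tm Γ ⌜ neg A ⌝) (P₂ : Tm Γ ⌜ neg B ⌝) (Q : Tm Γ ⌜ A ⌝) →
        _⋆_ {A = A ∨ B} ⟨ P₁ , P₂ ⟩ (σ₁ Q) ↦βπ _⋆_ {A = A} P₁ Q
  π₂  : ∀ {A B} (P₁ : Tm Γ ⌜ neg A ⌝) (P₂ : Tm Γ ⌜ neg B ⌝) (Q : Tm Γ ⌜ B ⌝) →
        _⋆_ {A = A ∨ B} ⟨ P₁ , P₂ ⟩ (σ₂ Q) ↦βπ _⋆_ {A = B} P₂ Q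
  π⊥₁ : ∀ {A B} (Q : Tm Γ ⌜ neg A ⌝) (P₁ : Tm Γ ⌜ A ⌝) (P₂ : Tm Γ ⌜ B ⌝) →
        _⋆_ {A = A ∧ B} (σ₁ Q) ⟨ P₁ , P₂ ⟩ ↦βπ _⋆_ {A = A} Q P₁
  π⊥₂ : ∀ {A B} (Q : Tm Γ ⌜ neg B ⌝) (P₁ : Tm Γ ⌜ A ⌝) (P₂ : Tm Γ ⌜ B ⌝) →
        _⋆_ {A = A ∧ B} (σ₂ Q) ⟨ P₁ , P₂ ⟩ ↦βπ _⋆_ {A = B} Q P₂

data _↦_ {Γ : Cx} : ∀ {C} → Tm Γ C → Tm Γ C → Set where
  βπ   : ∀ {C} {t u : Tm Γ C} → t ↦βπ u → t ↦ u
  η    : ∀ {A} (P : Tm Γ ⌜ neg A ⌝) →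
         ƛ {A = A} (_⋆_ {A = A} (rename there P) (var here)) ↦ P
  -- λx(x ⋆ P) → P,  x ∉ Fv(P)   (here x : B^⊥, so λx(..) : B^⊥⊥ = B)
  η⊥   : ∀ {B} (P : Tm Γ ⌜ B ⌝) →
         ƛ {A = neg B} (_⋆_ {A = B} (var here) (rename there P))
           ↦ castTm (sym (negneg B)) P
  -- E[P] → P,  E ≠ [-], E[P] : ⊥, P : ⊥, E binds no free variable of P
  triv : (Bs : Cx) (E : Hole Γ bot (Bs ++ Γ) bot) → isEmpty E ≡ false →
         (P : Tm Γ bot) → plug E (rename (wk* Bs) P) ↦ P

RootRel : Set₁
RootRel = ∀ {Γ C} → Tm Γ C → Tm Γ C → Set

data Compat (R : RootRel) : ∀ {Γ C} → Tm Γ C → Tm Γ C → Set where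
  root  : ∀ {Γ C} {t u : Tm Γ C} → R t u → Compat R t u
  pairL : ∀ {Γ A B} {t t' : Tm Γ ⌜ A ⌝} {u : Tm Γ ⌜ B ⌝} →
          Compat R t t' → Compat R ⟨ t , u ⟩ ⟨ t' , u ⟩
  pairR : ∀ {Γ A B} {t : Tm Γ ⌜ A ⌝} {u u' : Tm Γ ⌜ B ⌝} →
          Compat R u u' → Compat R ⟨ t , u ⟩ ⟨ t , u' ⟩
  σ₁C   : ∀ {Γ A B} {t t' : Tm Γ ⌜ A ⌝} →
          Compat R t t' → Compat R (σ₁ {B = B} t) (σ₁ t')
  σ₂C   : ∀ {Γ A B} {t t' : Tm Γ ⌜ B ⌝} →
          Compat R t t' → Compat R (σ₂ {A = A} t) (σ₂ t')
  ƛC    : ∀ {Γ A} {t t' : Tm (A ∷ Γ) bot} →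
          Compat R t t' → Compat R (ƛ t) (ƛ t')
  starL : ∀ {Γ A} {t t' : Tm Γ ⌜ neg A ⌝} {u : Tm Γ ⌜ A ⌝} →
          Compat R t t' → Compat R (t ⋆ u) (t' ⋆ u)
  starR : ∀ {Γ A} {t : Tm Γ ⌜ neg A ⌝} {u u' : Tm Γ ⌜ A ⌝} →
          Compat R u u' → Compat R (t ⋆ u) (t ⋆ u')

infix 4 _⟶βπ_ _⟶_

_⟶βπ_ : RootRel
_⟶βπ_ = Compat _↦βπ_

_⟶_ : RootRel
_⟶_ = Compat _↦_

SN : (R : RootRel) → ∀ {Γ C} → Tm Γ C → Set
SN R {Γ} {C} t = Acc (λ u v → R v u) t

module Submission where

-- We erase typed terms to raw de Bruijn terms; there η, η⊥ and
-- Triv become *deletions*, which strictly decrease the size.  Write x ⊒ y when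
-- y arises from x by deletions and by swapping the sides of ⋆ (a congruence
-- compatible with substitution).  The simulation lemma says: if x is βπ-SN
-- together with its subterms, x ⊒ y and y βπ-steps to z, then x makes at least
-- one βπ-step to some x' ⊒ z (deletions are postponed past βπ-steps).  So a
-- full reduction sequence from t is bounded by induction on βπ-reductions of
-- erase t, and, between βπ-steps, on the size of the current erasure.

open import Defs
open import Data.Nat using (ℕ; zero; suc; _+_; _<_; _≤_; s≤s)
open import Data.Nat.Properties
  using (+-suc; +-cancelʳ-≡; ≤-refl; ≤-reflexive; ≤-trans; m≤m+n; m≤n+m; m≤n⇒m≤1+n; <⇒≤; +-monoˡ-<; +-monoʳ-<)
open import Data.Nat.Induction using (<-wellFounded)
open import Data.Bool using (Bool; true; false; not) renaming (_∨_ to _or_)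
open import Data.List using ([]; _∷_; _++_; length)
open import Data.List.Properties using (length-++)
open import Data.Product using (Σ; _×_; _,_)
open import Data.Sum using (_⊎_; inj₁; inj₂)
import Data.Sum as Sum
open import Relation.Binary.PropositionalEquality hiding ([_])
open import Relation.Binary.Construct.Closure.Transitive
  using (TransClosure) renaming ([_] to one; _∷_ to _∷⁺_; _++_ to _++⁺_)
open import Function using (id; _∘_)
open import Induction.WellFounded using (Acc; acc)

-- Raw terms come in two sorts: `ms` for terms of an m-type, `bs` for terms of
-- type ⊥ (the commands P ⋆ Q).  The two injections σ₁, σ₂ share a constructor.
data Sort : Set where
  ms bs : Sort

data Side : Set where
  left right : Side

data Raw : Sort → Set where
  var  : ℕ → Raw ms
  lam  : Raw bs → Raw ms
  app  : Raw ms → Raw ms → Raw bs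
  pair : Raw ms → Raw ms → Raw ms
  inj  : Side → Raw ms → Raw ms

sel : Side → Raw ms → Raw ms → Raw ms
sel left  a c = a
sel right a c = c

Renaming : Set
Renaming = ℕ → ℕ

lift : Renaming → Renaming
lift f zero    = zero
lift f (suc n) = suc (f n)

ren : ∀ {s} → Renaming → Raw s → Raw s
ren f (var n)    = var (f n)
ren f (lam b)    = lam (ren (lift f) b)
ren f (app a c)  = app (ren f a) (ren f c)
ren f (pair a c) = pair (ren f a) (ren f c)
ren f (inj i a)  = inj i (ren f a)

Subst : Set
Subst = ℕ → Raw ms

lifts : Subst → Subst
lifts σ zero    = var zero
lifts σ (suc n) = ren suc (σ n)

subst-raw : ∀ {s} → Subst → Raw s → Raw s
subst-raw σ (var n)    = σ n
subst-raw σ (lam b)    = lam (subst-raw (lifts σ) b)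
subst-raw σ (app a c)  = app (subst-raw σ a) (subst-raw σ c)
subst-raw σ (pair a c) = pair (subst-raw σ a) (subst-raw σ c)
subst-raw σ (inj i a)  = inj i (subst-raw σ a)

single-raw : Raw ms → Subst
single-raw q zero    = q
single-raw q (suc n) = var n

infix 8 _[_]ʳ
_[_]ʳ : ∀ {s} → Raw s → Raw ms → Raw s
b [ q ]ʳ = subst-raw (single-raw q) b

lift-cong : ∀ {f g : Renaming} → f ≗ g → lift f ≗ lift g
lift-cong h zero    = refl
lift-cong h (suc n) = cong suc (h n)

lifts-cong : ∀ {σ τ : Subst} → σ ≗ τ → lifts σ ≗ lifts τ
lifts-cong h zero    = refl
lifts-cong h (suc n) = cong (ren suc) (h n)

ren-cong : ∀ {s} {f g : Renaming} → f ≗ g → (x : Raw s) → ren f x ≡ ren g x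
ren-cong h (var n)    = cong var (h n)
ren-cong h (lam b)    = cong lam (ren-cong (lift-cong h) b)
ren-cong h (app a c)  = cong₂ app (ren-cong h a) (ren-cong h c)
ren-cong h (pair a c) = cong₂ pair (ren-cong h a) (ren-cong h c)
ren-cong h (inj i a)  = cong (inj i) (ren-cong h a)

subst-cong : ∀ {s} {σ τ : Subst} → σ ≗ τ → (x : Raw s) → subst-raw σ x ≡ subst-raw τ x
subst-cong h (var n)    = h n
subst-cong h (lam b)    = cong lam (subst-cong (lifts-cong h) b)
subst-cong h (app a c)  = cong₂ app (subst-cong h a) (subst-cong h c)
subst-cong h (pair a c) = cong₂ pair (subst-cong h a) (subst-cong h c)
subst-cong h (inj i a)  = cong (inj i) (subst-cong h a)

ren-id : ∀ {s} {f : Renaming} → f ≗ id → (x : Raw s) → ren f x ≡ x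
ren-id h (var n)    = cong var (h n)
ren-id h (lam b)    = cong lam (ren-id (λ n → trans (lift-cong h n) (lift-id n)) b)
  where lift-id : lift id ≗ id
        lift-id zero    = refl
        lift-id (suc n) = refl
ren-id h (app a c)  = cong₂ app (ren-id h a) (ren-id h c)
ren-id h (pair a c) = cong₂ pair (ren-id h a) (ren-id h c)
ren-id h (inj i a)  = cong (inj i) (ren-id h a)

subst-id : ∀ {s} {σ : Subst} → σ ≗ var → (x : Raw s) → subst-raw σ x ≡ x
subst-id h (var n)    = h n
subst-id h (lam b)    = cong lam (subst-id (λ n → trans (lifts-cong h n) (lifts-var n)) b)
  where lifts-var : lifts var ≗ var
        lifts-var zero    = refl
        lifts-var (suc n) = refl
subst-id h (app a c)  = cong₂ app (subst-id h a) (subst-id h c)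
subst-id h (pair a c) = cong₂ pair (subst-id h a) (subst-id h c)
subst-id h (inj i a)  = cong (inj i) (subst-id h a)

ren-ren : ∀ {s} (f g : Renaming) (x : Raw s) → ren f (ren g x) ≡ ren (f ∘ g) x
ren-ren f g (var n)    = refl
ren-ren f g (lam b)    = cong lam (trans (ren-ren (lift f) (lift g) b) (ren-cong lift-∘ b))
  where lift-∘ : lift f ∘ lift g ≗ lift (f ∘ g)
        lift-∘ zero    = refl
        lift-∘ (suc n) = refl
ren-ren f g (app a c)  = cong₂ app (ren-ren f g a) (ren-ren f g c)
ren-ren f g (pair a c) = cong₂ pair (ren-ren f g a) (ren-ren f g c)
ren-ren f g (inj i a)  = cong (inj i) (ren-ren f g a)

subst-ren : ∀ {s} (σ : Subst) (f : Renaming) (x : Raw s) →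
            subst-raw σ (ren f x) ≡ subst-raw (σ ∘ f) x
subst-ren σ f (var n)    = refl
subst-ren σ f (lam b)    = cong lam (trans (subst-ren (lifts σ) (lift f) b) (subst-cong lifts-∘ b))
  where lifts-∘ : lifts σ ∘ lift f ≗ lifts (σ ∘ f)
        lifts-∘ zero    = refl
        lifts-∘ (suc n) = refl
subst-ren σ f (app a c)  = cong₂ app (subst-ren σ f a) (subst-ren σ f c)
subst-ren σ f (pair a c) = cong₂ pair (subst-ren σ f a) (subst-ren σ f c)
subst-ren σ f (inj i a)  = cong (inj i) (subst-ren σ f a)

ren-subst : ∀ {s} (f : Renaming) (σ : Subst) (x : Raw s) →
            ren f (subst-raw σ x) ≡ subst-raw (ren f ∘ σ) x
ren-subst f σ (var n)    = refl
ren-subst f σ (lam b)    = cong lam (trans (ren-subst (lift f) (lifts σ) b) (subst-cong ren-lifts b))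
  where ren-lifts : ren (lift f) ∘ lifts σ ≗ lifts (ren f ∘ σ)
        ren-lifts zero    = refl
        ren-lifts (suc n) = trans (ren-ren (lift f) suc (σ n)) (sym (ren-ren suc f (σ n)))
ren-subst f σ (app a c)  = cong₂ app (ren-subst f σ a) (ren-subst f σ c)
ren-subst f σ (pair a c) = cong₂ pair (ren-subst f σ a) (ren-subst f σ c)
ren-subst f σ (inj i a)  = cong (inj i) (ren-subst f σ a)

weaken-subst : ∀ {s} (q : Raw ms) (p : Raw s) → (ren suc p) [ q ]ʳ ≡ p
weaken-subst q p = trans (subst-ren (single-raw q) suc p) (subst-id (λ _ → refl) p)

ren-single : ∀ {s} (f : Renaming) (q : Raw ms) (b : Raw s) →
             ren f (b [ q ]ʳ) ≡ (ren (lift f) b) [ ren f q ]ʳ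
ren-single f q b =
  trans (ren-subst f (single-raw q) b)
        (trans (subst-cong ren-single-raw b) (sym (subst-ren (single-raw (ren f q)) (lift f) b)))
  where ren-single-raw : ren f ∘ single-raw q ≗ single-raw (ren f q) ∘ lift f
        ren-single-raw zero    = refl
        ren-single-raw (suc n) = refl

ren-weaken : ∀ {s} (f : Renaming) (p : Raw s) → ren (lift f) (ren suc p) ≡ ren suc (ren f p)
ren-weaken f p = trans (ren-ren (lift f) suc p) (sym (ren-ren suc f p))

subst-weaken : ∀ {s} (σ : Subst) (p : Raw s) →
               subst-raw (lifts σ) (ren suc p) ≡ ren suc (subst-raw σ p)
subst-weaken σ p = trans (subst-ren (lifts σ) suc p) (sym (ren-subst suc σ p))

-- k-fold lifting, and how it acts on a term weakened by k binders (Triv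
-- deletes a context crossing k binders, so its residual is such a term)
liftN : ℕ → Renaming → Renaming
liftN zero    f = f
liftN (suc k) f = liftN k (lift f)

liftsN : ℕ → Subst → Subst
liftsN zero    σ = σ
liftsN (suc k) σ = liftsN k (lifts σ)

liftN-shift : ∀ k f n → liftN k f (k + n) ≡ k + f n
liftN-shift zero    f n = refl
liftN-shift (suc k) f n =
  trans (cong (liftN k (lift f)) (sym (+-suc k n)))
        (trans (liftN-shift k (lift f) (suc n)) (+-suc k (f n)))

liftsN-shift : ∀ k σ n → liftsN k σ (k + n) ≡ ren (k +_) (σ n)
liftsN-shift zero    σ n = sym (ren-id (λ _ → refl) (σ n))
liftsN-shift (suc k) σ n =
  trans (cong (liftsN k (lifts σ)) (sym (+-suc k n)))
        (trans (liftsN-shift k (lifts σ) (suc n))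
               (trans (ren-ren (k +_) suc (σ n)) (ren-cong (+-suc k) (σ n))))

ren-shift : ∀ {s} k f (p : Raw s) → ren (liftN k f) (ren (k +_) p) ≡ ren (k +_) (ren f p)
ren-shift k f p =
  trans (ren-ren (liftN k f) (k +_) p)
        (trans (ren-cong (liftN-shift k f) p) (sym (ren-ren (k +_) f p)))

subst-shift : ∀ {s} k σ (p : Raw s) →
              subst-raw (liftsN k σ) (ren (k +_) p) ≡ ren (k +_) (subst-raw σ p)
subst-shift k σ p =
  trans (subst-ren (liftsN k σ) (k +_) p)
        (trans (subst-cong (liftsN-shift k σ) p) (sym (ren-subst (k +_) σ p)))

-- Occ p k x y : y occurs in x below k binders; p says whether the occurrence
-- is proper (p = false only for x itself).  Triv erases a proper command
-- occurrence; subterm-closed strong normalisation walks through occurrences.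
data Occ : ∀ {s s'} → Bool → ℕ → Raw s → Raw s' → Set where
  here    : ∀ {s} {y : Raw s} → Occ false 0 y y
  inLam   : ∀ {s p k b} {y : Raw s} → Occ p k b y → Occ true (suc k) (lam b) y
  inAppL  : ∀ {s p k a c} {y : Raw s} → Occ p k a y → Occ true k (app a c) y
  inAppR  : ∀ {s p k a c} {y : Raw s} → Occ p k c y → Occ true k (app a c) y
  inPairL : ∀ {s p k a c} {y : Raw s} → Occ p k a y → Occ true k (pair a c) y
  inPairR : ∀ {s p k a c} {y : Raw s} → Occ p k c y → Occ true k (pair a c) y
  inInj   : ∀ {s p k i a} {y : Raw s} → Occ p k a y → Occ true k (inj i a) y

occ-trans : ∀ {s s' s'' p q j k} {x : Raw s} {y : Raw s'} {z : Raw s''} →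
            Occ p j x y → Occ q k y z → Occ (p or q) (j + k) x z
occ-trans here         o = o
occ-trans (inLam o₁)   o = inLam (occ-trans o₁ o)
occ-trans (inAppL o₁)  o = inAppL (occ-trans o₁ o)
occ-trans (inAppR o₁)  o = inAppR (occ-trans o₁ o)
occ-trans (inPairL o₁) o = inPairL (occ-trans o₁ o)
occ-trans (inPairR o₁) o = inPairR (occ-trans o₁ o)
occ-trans (inInj o₁)   o = inInj (occ-trans o₁ o)

occ-ren : ∀ {s s' p k} (f : Renaming) {x : Raw s} {y : Raw s'} →
          Occ p k x y → Occ p k (ren f x) (ren (liftN k f) y)
occ-ren f here        = here
occ-ren f (inLam o)   = inLam (occ-ren (lift f) o)
occ-ren f (inAppL o)  = inAppL (occ-ren f o)
occ-ren f (inAppR o)  = inAppR (occ-ren f o)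
occ-ren f (inPairL o) = inPairL (occ-ren f o)
occ-ren f (inPairR o) = inPairR (occ-ren f o)
occ-ren f (inInj o)   = inInj (occ-ren f o)

occ-subst : ∀ {s s' p k} (σ : Subst) {x : Raw s} {y : Raw s'} →
            Occ p k x y → Occ p k (subst-raw σ x) (subst-raw (liftsN k σ) y)
occ-subst σ here        = here
occ-subst σ (inLam o)   = inLam (occ-subst (lifts σ) o)
occ-subst σ (inAppL o)  = inAppL (occ-subst σ o)
occ-subst σ (inAppR o)  = inAppR (occ-subst σ o)
occ-subst σ (inPairL o) = inPairL (occ-subst σ o)
occ-subst σ (inPairR o) = inPairR (occ-subst σ o)
occ-subst σ (inInj o)   = inInj (occ-subst σ o)

RawRel : Set₁
RawRel = ∀ {s} → Raw s → Raw s → Set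

infix 4 _▷βπ_ _▷del_

data _▷βπ_ : RawRel where
  β  : ∀ b q → app (lam b) q ▷βπ b [ q ]ʳ
  β⊥ : ∀ q b → app q (lam b) ▷βπ b [ q ]ʳ
  π  : ∀ i p₁ p₂ q → app (pair p₁ p₂) (inj i q) ▷βπ app (sel i p₁ p₂) q
  π⊥ : ∀ i q p₁ p₂ → app (inj i q) (pair p₁ p₂) ▷βπ app q (sel i p₁ p₂)

-- root deletions: η, η⊥, and Triv (a command replaced by a proper command
-- occurrence inside it not using the variables bound on the way)
data _▷del_ : RawRel where
  η    : ∀ p → lam (app (ren suc p) (var 0)) ▷del p
  η⊥   : ∀ p → lam (app (var 0) (ren suc p)) ▷del p
  triv : ∀ {k} {x p : Raw bs} → Occ true k x (ren (k +_) p) → x ▷del p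

data Cl (R : RawRel) : RawRel where
  root  : ∀ {s} {x y : Raw s} → R x y → Cl R x y
  lamC  : ∀ {b b'} → Cl R b b' → Cl R (lam b) (lam b')
  appL  : ∀ {a a' c} → Cl R a a' → Cl R (app a c) (app a' c)
  appR  : ∀ {a c c'} → Cl R c c' → Cl R (app a c) (app a c')
  pairL : ∀ {a a' c} → Cl R a a' → Cl R (pair a c) (pair a' c)
  pairR : ∀ {a c c'} → Cl R c c' → Cl R (pair a c) (pair a c')
  injC  : ∀ {i a a'} → Cl R a a' → Cl R (inj i a) (inj i a')

infix 4 _⇒βπ_ _⇒del_ _⇒βπ⁺_

_⇒βπ_ : RawRel
_⇒βπ_ = Cl _▷βπ_

_⇒del_ : RawRel
_⇒del_ = Cl _▷del_

_⇒βπ⁺_ : RawRel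
_⇒βπ⁺_ = TransClosure _⇒βπ_

map⁺ : ∀ {s s'} {F : Raw s → Raw s'} → (∀ {x y} → x ⇒βπ y → F x ⇒βπ F y) →
       ∀ {x y} → x ⇒βπ⁺ y → F x ⇒βπ⁺ F y
map⁺ h (one r)  = one (h r)
map⁺ h (r ∷⁺ rs) = h r ∷⁺ map⁺ h rs

Ren-stable : RawRel → Set
Ren-stable R = ∀ {s} (f : Renaming) {x y : Raw s} → R x y → R (ren f x) (ren f y)

Cl-ren : ∀ {R : RawRel} → Ren-stable R → Ren-stable (Cl R)
Cl-ren h f (root r)  = root (h f r)
Cl-ren h f (lamC r)  = lamC (Cl-ren h (lift f) r)
Cl-ren h f (appL r)  = appL (Cl-ren h f r)
Cl-ren h f (appR r)  = appR (Cl-ren h f r)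
Cl-ren h f (pairL r) = pairL (Cl-ren h f r)
Cl-ren h f (pairR r) = pairR (Cl-ren h f r)
Cl-ren h f (injC r)  = injC (Cl-ren h f r)

▷βπ-ren : Ren-stable _▷βπ_
▷βπ-ren f (β b q)  =
  subst (app (lam (ren (lift f) b)) (ren f q) ▷βπ_) (sym (ren-single f q b)) (β _ _)
▷βπ-ren f (β⊥ q b) =
  subst (app (ren f q) (lam (ren (lift f) b)) ▷βπ_) (sym (ren-single f q b)) (β⊥ _ _)
▷βπ-ren f (π left p₁ p₂ q)   = π left _ _ _
▷βπ-ren f (π right p₁ p₂ q)  = π right _ _ _
▷βπ-ren f (π⊥ left q p₁ p₂)  = π⊥ left _ _ _
▷βπ-ren f (π⊥ right q p₁ p₂) = π⊥ right _ _ _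

⇒βπ-ren : Ren-stable _⇒βπ_
⇒βπ-ren = Cl-ren ▷βπ-ren

▷del-ren : Ren-stable _▷del_
▷del-ren f (η p)  =
  subst (λ z → lam (app z (var 0)) ▷del ren f p) (sym (ren-weaken f p)) (η _)
▷del-ren f (η⊥ p) =
  subst (λ z → lam (app (var 0) z) ▷del ren f p) (sym (ren-weaken f p)) (η⊥ _)
▷del-ren f (triv {k} {x} {p} o) = triv (subst (Occ true k (ren f x)) (ren-shift k f p) (occ-ren f o))

⇒del-ren : Ren-stable _⇒del_
⇒del-ren = Cl-ren ▷del-ren

▷del-subst : ∀ {s} (σ : Subst) {x y : Raw s} → x ▷del y → subst-raw σ x ▷del subst-raw σ y
▷del-subst σ (η p)  =
  subst (λ z → lam (app z (var 0)) ▷del subst-raw σ p) (sym (subst-weaken σ p)) (η _)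
▷del-subst σ (η⊥ p) =
  subst (λ z → lam (app (var 0) z) ▷del subst-raw σ p) (sym (subst-weaken σ p)) (η⊥ _)
▷del-subst σ (triv {k} {x} {p} o) =
  triv (subst (Occ true k (subst-raw σ x)) (subst-shift k σ p) (occ-subst σ o))

occ-step : ∀ {R : RawRel} {s s' p k} {w : Raw s} {y y' : Raw s'} →
           Occ p k w y → Cl R y y' → Σ (Raw s) λ w' → Cl R w w' × Occ p k w' y'
occ-step here        r = _ , r , here
occ-step (inLam o)   r = let _ , r' , o' = occ-step o r in _ , lamC r' , inLam o'
occ-step (inAppL o)  r = let _ , r' , o' = occ-step o r in _ , appL r' , inAppL o'
occ-step (inAppR o)  r = let _ , r' , o' = occ-step o r in _ , appR r' , inAppR o'
occ-step (inPairL o) r = let _ , r' , o' = occ-step o r in _ , pairL r' , inPairL o'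
occ-step (inPairR o) r = let _ , r' , o' = occ-step o r in _ , pairR r' , inPairR o'
occ-step (inInj o)   r = let _ , r' , o' = occ-step o r in _ , injC r' , inInj o'

-- The deleted context never contains the variables of the residual term, so
-- the step is performed on a weakened copy; this needs stability under renaming.
del-postpone : ∀ {R : RawRel} → Ren-stable (Cl R) → ∀ {s} {w y z : Raw s} →
               w ▷del y → Cl R y z → Σ (Raw s) λ w' → Cl R w w' × w' ▷del z
del-postpone h (η p)  r = _ , lamC (appL (h suc r)) , η _
del-postpone h (η⊥ p) r = _ , lamC (appR (h suc r)) , η⊥ _
del-postpone h (triv {k} o) r =
  let w' , r' , o' = occ-step o (h (k +_) r) in w' , r' , triv o'

-- Swaps are needed because η⊥ turns a π-redex
-- into a π⊥-redex whose contractum has its two sides exchanged.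
infix 4 _⊒_
data _⊒_ : RawRel where
  rfl   : ∀ {s} {x : Raw s} → x ⊒ x
  lamC  : ∀ {b b'} → b ⊒ b' → lam b ⊒ lam b'
  appC  : ∀ {a a' c c'} → a ⊒ a' → c ⊒ c' → app a c ⊒ app a' c'
  pairC : ∀ {a a' c c'} → a ⊒ a' → c ⊒ c' → pair a c ⊒ pair a' c'
  injC  : ∀ {i a a'} → a ⊒ a' → inj i a ⊒ inj i a'
  del   : ∀ {s} {x w y : Raw s} → x ⊒ w → w ▷del y → x ⊒ y
  swap  : ∀ {x a c} → x ⊒ app a c → x ⊒ app c a

⊒-ren : Ren-stable _⊒_
⊒-ren f rfl         = rfl
⊒-ren f (lamC d)    = lamC (⊒-ren (lift f) d)
⊒-ren f (appC d e)  = appC (⊒-ren f d) (⊒-ren f e)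
⊒-ren f (pairC d e) = pairC (⊒-ren f d) (⊒-ren f e)
⊒-ren f (injC d)    = injC (⊒-ren f d)
⊒-ren f (del d r)   = del (⊒-ren f d) (▷del-ren f r)
⊒-ren f (swap d)    = swap (⊒-ren f d)

_⊒ˢ_ : Subst → Subst → Set
σ ⊒ˢ τ = ∀ n → σ n ⊒ τ n

lifts-⊒ : ∀ {σ τ} → σ ⊒ˢ τ → lifts σ ⊒ˢ lifts τ
lifts-⊒ h zero    = rfl
lifts-⊒ h (suc n) = ⊒-ren suc (h n)

subst-⊒ʳ : ∀ {s σ τ} → σ ⊒ˢ τ → (x : Raw s) → subst-raw σ x ⊒ subst-raw τ x
subst-⊒ʳ h (var n)    = h n
subst-⊒ʳ h (lam b)    = lamC (subst-⊒ʳ (lifts-⊒ h) b)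
subst-⊒ʳ h (app a c)  = appC (subst-⊒ʳ h a) (subst-⊒ʳ h c)
subst-⊒ʳ h (pair a c) = pairC (subst-⊒ʳ h a) (subst-⊒ʳ h c)
subst-⊒ʳ h (inj i a)  = injC (subst-⊒ʳ h a)

subst-⊒ : ∀ {s σ τ} → σ ⊒ˢ τ → {x y : Raw s} → x ⊒ y → subst-raw σ x ⊒ subst-raw τ y
subst-⊒ h {x} rfl           = subst-⊒ʳ h x
subst-⊒ h (lamC d)          = lamC (subst-⊒ (lifts-⊒ h) d)
subst-⊒ h (appC d e)        = appC (subst-⊒ h d) (subst-⊒ h e)
subst-⊒ h (pairC d e)       = pairC (subst-⊒ h d) (subst-⊒ h e)
subst-⊒ h (injC d)          = injC (subst-⊒ h d)
subst-⊒ {τ = τ} h (del d r) = del (subst-⊒ h d) (▷del-subst τ r)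
subst-⊒ h (swap d)          = swap (subst-⊒ h d)

single-⊒ : ∀ {s} {b b' : Raw s} {q q'} → b ⊒ b' → q ⊒ q' → b [ q ]ʳ ⊒ b' [ q' ]ʳ
single-⊒ {q = q} {q'} d e = subst-⊒ single-⊒ˢ d
  where single-⊒ˢ : single-raw q ⊒ˢ single-raw q'
        single-⊒ˢ zero    = e
        single-⊒ˢ (suc n) = rfl

del-⊒ : ∀ {s} {y z : Raw s} → y ⇒del z → y ⊒ z
del-⊒ (root r)  = del rfl r
del-⊒ (lamC r)  = lamC (del-⊒ r)
del-⊒ (appL r)  = appC (del-⊒ r) rfl
del-⊒ (appR r)  = appC rfl (del-⊒ r)
del-⊒ (pairL r) = pairC (del-⊒ r) rfl
del-⊒ (pairR r) = pairC rfl (del-⊒ r)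
del-⊒ (injC r)  = injC (del-⊒ r)

-- ⊒ is closed under further deletion steps; a deletion below an earlier root
-- deletion is first postponed past it
⊒-del : ∀ {s} {x y z : Raw s} → x ⊒ y → y ⇒del z → x ⊒ z
⊒-del rfl         r         = del-⊒ r
⊒-del d           (root r)  = del d r
⊒-del (lamC d)    (lamC r)  = lamC (⊒-del d r)
⊒-del (appC d e)  (appL r)  = appC (⊒-del d r) e
⊒-del (appC d e)  (appR r)  = appC d (⊒-del e r)
⊒-del (pairC d e) (pairL r) = pairC (⊒-del d r) e
⊒-del (pairC d e) (pairR r) = pairC d (⊒-del e r)
⊒-del (injC d)    (injC r)  = injC (⊒-del d r)
⊒-del (del d r₀)  r         =
  let _ , r' , r₀' = del-postpone ⇒del-ren r₀ r in del (⊒-del d r') r₀'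
⊒-del (swap d)    (appL r)  = swap (⊒-del d (appR r))
⊒-del (swap d)    (appR r)  = swap (⊒-del d (appL r))

size : ∀ {s} → Raw s → ℕ
size (var n)    = 1
size (lam b)    = suc (size b)
size (app a c)  = suc (size a + size c)
size (pair a c) = suc (size a + size c)
size (inj i a)  = suc (size a)

size-ren : ∀ {s} (f : Renaming) (x : Raw s) → size (ren f x) ≡ size x
size-ren f (var n)    = refl
size-ren f (lam b)    = cong suc (size-ren (lift f) b)
size-ren f (app a c)  = cong suc (cong₂ _+_ (size-ren f a) (size-ren f c))
size-ren f (pair a c) = cong suc (cong₂ _+_ (size-ren f a) (size-ren f c))
size-ren f (inj i a)  = cong suc (size-ren f a)

occ-size : ∀ {s s' p k} {x : Raw s} {y : Raw s'} → Occ p k x y → size y ≤ size x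
proper-occ-size : ∀ {s s' k} {x : Raw s} {y : Raw s'} → Occ true k x y → size y < size x

occ-size here           = ≤-refl
occ-size {p = true} o   = <⇒≤ (proper-occ-size o)

proper-occ-size (inLam o)               = s≤s (occ-size o)
proper-occ-size (inAppL {a = a} {c} o)  = s≤s (≤-trans (occ-size o) (m≤m+n (size a) (size c)))
proper-occ-size (inAppR {a = a} {c} o)  = s≤s (≤-trans (occ-size o) (m≤n+m (size c) (size a)))
proper-occ-size (inPairL {a = a} {c} o) = s≤s (≤-trans (occ-size o) (m≤m+n (size a) (size c)))
proper-occ-size (inPairR {a = a} {c} o) = s≤s (≤-trans (occ-size o) (m≤n+m (size c) (size a)))
proper-occ-size (inInj o)               = s≤s (occ-size o)

del-size : ∀ {s} {y z : Raw s} → y ⇒del z → size z < size y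
del-size (root (η p))  =
  s≤s (m≤n⇒m≤1+n (≤-trans (≤-reflexive (sym (size-ren suc p))) (m≤m+n _ 1)))
del-size (root (η⊥ p)) =
  s≤s (m≤n⇒m≤1+n (≤-trans (≤-reflexive (sym (size-ren suc p))) (m≤n+m _ 1)))
del-size (root (triv {k} {x} {p} o)) = subst (_< size x) (size-ren (k +_) p) (proper-occ-size o)
del-size (lamC r)            = s≤s (del-size r)
del-size (appL {c = c} r)    = s≤s (+-monoˡ-< (size c) (del-size r))
del-size (appR {a = a} r)    = s≤s (+-monoʳ-< (size a) (del-size r))
del-size (pairL {c = c} r)   = s≤s (+-monoˡ-< (size c) (del-size r))
del-size (pairR {a = a} r)   = s≤s (+-monoʳ-< (size a) (del-size r))
del-size (injC r)            = s≤s (del-size r)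

-- SNsub x: all βπ⁺-reducts and all immediate subterms of x are SNsub.  The
-- simulation lemma recurses along both, so it needs this inductive form.
data SNsub : ∀ {s} → Raw s → Set
data SubtermsSN : ∀ {s} → Raw s → Set

data SNsub where
  sn : ∀ {s} {x : Raw s} → (∀ {y} → x ⇒βπ⁺ y → SNsub y) → SubtermsSN x → SNsub x

data SubtermsSN where
  sVar  : ∀ {n} → SubtermsSN (var n)
  sLam  : ∀ {b} → SNsub b → SubtermsSN (lam b)
  sApp  : ∀ {a c} → SNsub a → SNsub c → SubtermsSN (app a c)
  sPair : ∀ {a c} → SNsub a → SNsub c → SubtermsSN (pair a c)
  sInj  : ∀ {i a} → SNsub a → SubtermsSN (inj i a)

Sim : ∀ {s} → Raw s → Raw s → Set
Sim {s} x z = Σ (Raw s) λ x' → x ⇒βπ⁺ x' × x' ⊒ z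

sim-swap : ∀ {x a c} → Sim x (app a c) → Sim x (app c a)
sim-swap (x' , rs , d) = x' , rs , swap d

sim-prefix : ∀ {s} {x x'' z : Raw s} → x ⇒βπ⁺ x'' → Sim x'' z → Sim x z
sim-prefix rs (x' , rs' , d) = x' , rs ++⁺ rs' , d

-- the weakened head created by η (resp. η⊥) is restored by the substitution
sim-η : ∀ {x : Raw bs} {v q} → Sim x (app (ren suc v [ q ]ʳ) q) → Sim x (app v q)
sim-η {x} {v} {q} = subst (λ z → Sim x (app z q)) (weaken-subst q v)

sim-η⊥ : ∀ {x : Raw bs} {v q} → Sim x (app q (ren suc v [ q ]ʳ)) → Sim x (app q v)
sim-η⊥ {x} {v} {q} = subst (λ z → Sim x (app q z)) (weaken-subst q v)

ap : Bool → Raw ms → Raw ms → Raw bs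
ap true  a c = app a c
ap false a c = app c a

β-ap : ∀ o b q → ap o (lam b) q ▷βπ b [ q ]ʳ
β-ap true  b q = β b q
β-ap false b q = β⊥ q b

π-ap : ∀ o i p₁ p₂ q → ap o (pair p₁ p₂) (inj i q) ▷βπ ap o (sel i p₁ p₂) q
π-ap true  i p₁ p₂ q = π i p₁ p₂ q
π-ap false i p₁ p₂ q = π⊥ i q p₁ p₂

ap-⊒ : ∀ o {a a' c c'} → a ⊒ a' → c ⊒ c' → ap o a c ⊒ app a' c'
ap-⊒ true  d e = appC d e
ap-⊒ false d e = swap (appC e d)

sel-⊒ : ∀ i {a a' c c'} → a ⊒ a' → c ⊒ c' → sel i a c ⊒ sel i a' c'
sel-⊒ left  d e = d
sel-⊒ right d e = e

-- The main difficulty is a redex of y whose head was created by deletions in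
-- x; the auxiliary lemmas sim-β and sim-π treat these by recursion on ⊒.
simulate : ∀ {s} {x y z : Raw s} → SNsub x → x ⊒ y → y ⇒βπ z → Sim x z

sim-then : ∀ {s} {x y z : Raw s} → SNsub x → Sim x y → y ⇒βπ z → Sim x z

sim-β : ∀ o {xa xb b q} → SNsub (ap o xa xb) → xa ⊒ lam b → xb ⊒ q →
        Sim (ap o xa xb) (b [ q ]ʳ)

sim-π : ∀ o i {xa xb p₁ p₂ q} → SNsub (ap o xa xb) →
        xa ⊒ pair p₁ p₂ → xb ⊒ inj i q → Sim (ap o xa xb) (app (sel i p₁ p₂) q)

sim-π-pair : ∀ o i {a₁ a₂ xb p₁ p₂ q} → SNsub (ap o (pair a₁ a₂) xb) →
             a₁ ⊒ p₁ → a₂ ⊒ p₂ → xb ⊒ inj i q →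
             Sim (ap o (pair a₁ a₂) xb) (app (sel i p₁ p₂) q)

sim-then (sn reducts _) (x'' , rs , d) r = sim-prefix rs (simulate (reducts rs) d r)

simulate _ rfl r = _ , one r , rfl
simulate (sn _ (sLam sb)) (lamC d) (lamC r) =
  let x' , rs , d' = simulate sb d r in _ , map⁺ lamC rs , lamC d'
simulate (sn _ (sApp sa _)) (appC d e) (appL r) =
  let x' , rs , d' = simulate sa d r in _ , map⁺ appL rs , appC d' e
simulate (sn _ (sApp _ sc)) (appC d e) (appR r) =
  let x' , rs , d' = simulate sc e r in _ , map⁺ appR rs , appC d d'
simulate (sn _ (sPair sa _)) (pairC d e) (pairL r) =
  let x' , rs , d' = simulate sa d r in _ , map⁺ pairL rs , pairC d' e
simulate (sn _ (sPair _ sc)) (pairC d e) (pairR r) =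
  let x' , rs , d' = simulate sc e r in _ , map⁺ pairR rs , pairC d d'
simulate (sn _ (sInj sa)) (injC d) (injC r) =
  let x' , rs , d' = simulate sa d r in _ , map⁺ injC rs , injC d'
simulate s (appC d e) (root (β _ _))      = sim-β true s d e
simulate s (appC d e) (root (β⊥ _ _))     = sim-β false s e d
simulate s (appC d e) (root (π i _ _ _))  = sim-π true i s d e
simulate s (appC d e) (root (π⊥ i _ _ _)) = sim-swap (sim-π false i s e d)
simulate s (del d r₀) r =
  let _ , r' , r₀' = del-postpone ⇒βπ-ren r₀ r
      x' , rs , d' = simulate s d r'
  in x' , rs , del d' r₀'
simulate s (swap d) (appL r)              = sim-swap (simulate s d (appR r))
simulate s (swap d) (appR r)              = sim-swap (simulate s d (appL r))
simulate s (swap d) (root (β b q))        = simulate s d (root (β⊥ q b))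
simulate s (swap d) (root (β⊥ q b))       = simulate s d (root (β b q))
simulate s (swap d) (root (π i p₁ p₂ q))  = sim-swap (simulate s d (root (π⊥ i q p₁ p₂)))
simulate s (swap d) (root (π⊥ i q p₁ p₂)) = sim-swap (simulate s d (root (π i p₁ p₂ q)))

-- If the abstraction of the redex is hidden behind η or η⊥ in x, then
-- x ⋆ q first β-reduces to a term above the redex with the abstraction
-- exposed, and then performs the β-step itself; likewise for pairs.
sim-β o {b = b} s rfl      e = _ , one (root (β-ap o b _)) , single-⊒ {b = b} rfl e
sim-β o         s (lamC d) e = _ , one (root (β-ap o _ _)) , single-⊒ d e
sim-β o {b = b} s (del d (η _))  e =
  sim-then s (sim-η {v = lam b} (sim-β o s d e)) (root (β b _))
sim-β o {b = b} s (del d (η⊥ _)) e =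
  sim-then s (sim-η⊥ {v = lam b} (sim-β o s d e)) (root (β⊥ _ b))

sim-π o i s rfl           e = sim-π-pair o i s rfl rfl e
sim-π o i s (pairC d₁ d₂) e = sim-π-pair o i s d₁ d₂ e
sim-π o i s (del d (η _))  e =
  sim-then s (sim-η (sim-β o s d e)) (root (π i _ _ _))
sim-π o i s (del d (η⊥ _)) e =
  sim-swap (sim-then s (sim-η⊥ (sim-β o s d e)) (root (π⊥ i _ _ _)))

sim-π-pair o i {a₁} {a₂} {q = q} s d₁ d₂ rfl =
  _ , one (root (π-ap o i a₁ a₂ q)) , ap-⊒ o (sel-⊒ i d₁ d₂) rfl
sim-π-pair o i {a₁} {a₂} s d₁ d₂ (injC {a = xq} e) =
  _ , one (root (π-ap o i a₁ a₂ xq)) , ap-⊒ o (sel-⊒ i d₁ d₂) e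
sim-π-pair true  i s d₁ d₂ (del e (η _)) =
  sim-swap (sim-then s (sim-η (sim-β false s e (pairC d₁ d₂))) (root (π⊥ i _ _ _)))
sim-π-pair false i s d₁ d₂ (del e (η _)) =
  sim-swap (sim-then s (sim-η (sim-β true s e (pairC d₁ d₂))) (root (π⊥ i _ _ _)))
sim-π-pair true  i s d₁ d₂ (del e (η⊥ _)) =
  sim-then s (sim-η⊥ (sim-β false s e (pairC d₁ d₂))) (root (π i _ _ _))
sim-π-pair false i s d₁ d₂ (del e (η⊥ _)) =
  sim-then s (sim-η⊥ (sim-β true s e (pairC d₁ d₂))) (root (π i _ _ _))

SN-raw : ∀ {s} → Raw s → Set
SN-raw x = Acc (λ a b → b ⇒βπ a) x

-- every subterm y of a βπ-SN term x is SNsub: reductions of y are reductions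
-- of x (so the accessibility proof of x decreases), subterms of y are
-- subterms of x (so y decreases structurally)
sn-occ : ∀ {s} {x : Raw s} → SN-raw x → ∀ {s' p k} (y : Raw s') → Occ p k x y → SNsub y
sn-occ-reducts : ∀ {s} {x : Raw s} → SN-raw x → ∀ {s' p k} {y y'' : Raw s'} →
                 Occ p k x y → y ⇒βπ⁺ y'' → SNsub y''

sn-occ-reducts (acc rec) o (one r) =
  let _ , r' , o' = occ-step o r in sn-occ (rec r') _ o'
sn-occ-reducts (acc rec) o (r ∷⁺ rs) =
  let _ , r' , o' = occ-step o r in sn-occ-reducts (rec r') o' rs

sn-occ a (var n)    o = sn (sn-occ-reducts a o) sVar
sn-occ a (lam b)    o = sn (sn-occ-reducts a o) (sLam (sn-occ a b (occ-trans o (inLam here))))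
sn-occ a (app u v)  o = sn (sn-occ-reducts a o)
  (sApp (sn-occ a u (occ-trans o (inAppL here))) (sn-occ a v (occ-trans o (inAppR here))))
sn-occ a (pair u v) o = sn (sn-occ-reducts a o)
  (sPair (sn-occ a u (occ-trans o (inPairL here))) (sn-occ a v (occ-trans o (inPairR here))))
sn-occ a (inj i u)  o = sn (sn-occ-reducts a o) (sInj (sn-occ a u (occ-trans o (inInj here))))

SN⇒SNsub : ∀ {s} {x : Raw s} → SN-raw x → SNsub x
SN⇒SNsub {x = x} a = sn-occ a x here

sortOf : Ty → Sort
sortOf ⌜ A ⌝ = ms
sortOf bot   = bs

idx : ∀ {Γ A} → Γ ∋ A → ℕ
idx here      = zero
idx (there x) = suc (idx x)

erase : ∀ {Γ C} → Tm Γ C → Raw (sortOf C)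
erase (var x)   = var (idx x)
erase ⟨ P , Q ⟩ = pair (erase P) (erase Q)
erase (σ₁ P)    = inj left (erase P)
erase (σ₂ P)    = inj right (erase P)
erase (ƛ P)     = lam (erase P)
erase (P ⋆ Q)   = app (erase P) (erase Q)

erase-ren : ∀ {Γ Δ C} (ρ : Ren Γ Δ) (f : Renaming) →
            (∀ {A} (x : Γ ∋ A) → idx (ρ x) ≡ f (idx x)) →
            (t : Tm Γ C) → erase (rename ρ t) ≡ ren f (erase t)
erase-ren ρ f h (var x)   = cong var (h x)
erase-ren ρ f h ⟨ P , Q ⟩ = cong₂ pair (erase-ren ρ f h P) (erase-ren ρ f h Q)
erase-ren ρ f h (σ₁ P)    = cong (inj left) (erase-ren ρ f h P)
erase-ren ρ f h (σ₂ P)    = cong (inj right) (erase-ren ρ f h P)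
erase-ren {Γ} ρ f h (ƛ {A} P) = cong lam (erase-ren (ext ρ) (lift f) h' P)
  where h' : ∀ {B} (x : (A ∷ Γ) ∋ B) → idx (ext ρ x) ≡ lift f (idx x)
        h' here      = refl
        h' (there x) = cong suc (h x)
erase-ren ρ f h (P ⋆ Q)   = cong₂ app (erase-ren ρ f h P) (erase-ren ρ f h Q)

erase-weaken : ∀ {Γ B C} (t : Tm Γ C) → erase (rename (there {B = B}) t) ≡ ren suc (erase t)
erase-weaken = erase-ren there suc (λ _ → refl)

erase-subst : ∀ {Γ Δ C} (σ : Sub Γ Δ) (τ : Subst) →
              (∀ {A} (x : Γ ∋ A) → erase (σ x) ≡ τ (idx x)) →
              (t : Tm Γ C) → erase (sub σ t) ≡ subst-raw τ (erase t)
erase-subst σ τ h (var x)   = h x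
erase-subst σ τ h ⟨ P , Q ⟩ = cong₂ pair (erase-subst σ τ h P) (erase-subst σ τ h Q)
erase-subst σ τ h (σ₁ P)    = cong (inj left) (erase-subst σ τ h P)
erase-subst σ τ h (σ₂ P)    = cong (inj right) (erase-subst σ τ h P)
erase-subst {Γ} σ τ h (ƛ {A} P) = cong lam (erase-subst (exts σ) (lifts τ) h' P)
  where h' : ∀ {B} (x : (A ∷ Γ) ∋ B) → erase (exts σ x) ≡ lifts τ (idx x)
        h' here      = refl
        h' (there x) = trans (erase-weaken (σ x)) (cong (ren suc) (h x))
erase-subst σ τ h (P ⋆ Q)   = cong₂ app (erase-subst σ τ h P) (erase-subst σ τ h Q)

erase-single : ∀ {Γ A C} (P : Tm (A ∷ Γ) C) (Q : Tm Γ ⌜ A ⌝) →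
               erase (P [ Q ]) ≡ erase P [ erase Q ]ʳ
erase-single {Γ} {A} P Q = erase-subst (single Q) (single-raw (erase Q)) h P
  where h : ∀ {B} (x : (A ∷ Γ) ∋ B) → erase (single Q x) ≡ single-raw (erase Q) (idx x)
        h here      = refl
        h (there x) = refl

erase-cast : ∀ {Γ A B} (e : A ≡ B) (P : Tm Γ ⌜ A ⌝) → erase (castTm e P) ≡ erase P
erase-cast refl P = refl

erase-▷βπ : ∀ {Γ C} {t u : Tm Γ C} → t ↦βπ u → erase t ▷βπ erase u
erase-▷βπ (β P Q) = subst (app (lam (erase P)) (erase Q) ▷βπ_) (sym (erase-single P Q)) (β _ _)
erase-▷βπ (β⊥ {A} Q P) = subst (app (erase Q) (lam (erase P)) ▷βπ_) (sym eq) (β⊥ _ _)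
  where eq : erase (P [ castTm (negneg A) Q ]) ≡ erase P [ erase Q ]ʳ
        eq = trans (erase-single P (castTm (negneg A) Q))
                   (cong (erase P [_]ʳ) (erase-cast (negneg A) Q))
erase-▷βπ (π₁ P₁ P₂ Q)  = π left _ _ _
erase-▷βπ (π₂ P₁ P₂ Q)  = π right _ _ _
erase-▷βπ (π⊥₁ Q P₁ P₂) = π⊥ left _ _ _
erase-▷βπ (π⊥₂ Q P₁ P₂) = π⊥ right _ _ _

depth : ∀ {Γ C Δ D} → Hole Γ C Δ D → ℕ
depth []          = zero
depth (pairL E _) = depth E
depth (pairR _ E) = depth E
depth (σ₁H E)     = depth E
depth (σ₂H E)     = depth E
depth (ƛH E)      = suc (depth E)
depth (starL E _) = depth E
depth (starR _ E) = depth E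

depth-length : ∀ {Γ C Δ D} (E : Hole Γ C Δ D) → length Δ ≡ depth E + length Γ
depth-length []          = refl
depth-length (pairL E _) = depth-length E
depth-length (pairR _ E) = depth-length E
depth-length (σ₁H E)     = depth-length E
depth-length (σ₂H E)     = depth-length E
depth-length (ƛH E)      = trans (depth-length E) (+-suc (depth E) _)
depth-length (starL E _) = depth-length E
depth-length (starR _ E) = depth-length E

occ-plug : ∀ {Γ C Δ D} (E : Hole Γ C Δ D) (Q : Tm Δ D) →
           Occ (not (isEmpty E)) (depth E) (erase (plug E Q)) (erase Q)
occ-plug []          Q = here
occ-plug (pairL E _) Q = inPairL (occ-plug E Q)
occ-plug (pairR _ E) Q = inPairR (occ-plug E Q)
occ-plug (σ₁H E)     Q = inInj (occ-plug E Q)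
occ-plug (σ₂H E)     Q = inInj (occ-plug E Q)
occ-plug (ƛH E)      Q = inLam (occ-plug E Q)
occ-plug (starL E _) Q = inAppL (occ-plug E Q)
occ-plug (starR _ E) Q = inAppR (occ-plug E Q)

idx-wk* : ∀ {Γ A} (Bs : Cx) (x : Γ ∋ A) → idx (wk* Bs x) ≡ length Bs + idx x
idx-wk* []       x = refl
idx-wk* (B ∷ Bs) x = cong suc (idx-wk* Bs x)

-- Triv erases to a raw Triv deletion: the hole crosses exactly the binders Bs
erase-triv : ∀ {Γ} (Bs : Cx) (E : Hole Γ bot (Bs ++ Γ) bot) → isEmpty E ≡ false →
             (P : Tm Γ bot) → erase (plug E (rename (wk* Bs) P)) ▷del erase P
erase-triv {Γ} Bs E nonempty P = triv (subst₂ Occ-in proper shifted (occ-plug E _))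
  where
    proper : not (isEmpty E) ≡ true
    proper = cong not nonempty
    binders : length Bs ≡ depth E
    binders = +-cancelʳ-≡ (length Γ) (length Bs) (depth E)
                (trans (sym (length-++ Bs)) (depth-length E))
    shifted : erase (rename (wk* Bs) P) ≡ ren (depth E +_) (erase P)
    shifted = trans (erase-ren (wk* Bs) (length Bs +_) (idx-wk* Bs) P)
                    (cong (λ k → ren (k +_) (erase P)) binders)
    Occ-in : Bool → Raw bs → Set
    Occ-in p y = Occ p (depth E) (erase (plug E (rename (wk* Bs) P))) y

erase-root : ∀ {Γ C} {t u : Tm Γ C} → t ↦ u →
             (erase t ▷βπ erase u) ⊎ (erase t ▷del erase u)
erase-root (βπ r) = inj₁ (erase-▷βπ r)
erase-root (η P) =
  inj₂ (subst (λ z → lam (app z (var 0)) ▷del erase P) (sym (erase-weaken P)) (η _))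
erase-root (η⊥ {B} P) =
  inj₂ (subst₂ (λ z w → lam (app (var 0) z) ▷del w)
               (sym (erase-weaken P)) (sym (erase-cast (sym (negneg B)) P)) (η⊥ _))
erase-root (triv Bs E nonempty P) = inj₂ (erase-triv Bs E nonempty P)

erase-step : ∀ {Γ C} {t u : Tm Γ C} → t ⟶ u →
             (erase t ⇒βπ erase u) ⊎ (erase t ⇒del erase u)
erase-step (root r)  = Sum.map root root (erase-root r)
erase-step (pairL r) = Sum.map pairL pairL (erase-step r)
erase-step (pairR r) = Sum.map pairR pairR (erase-step r)
erase-step (σ₁C r)   = Sum.map injC injC (erase-step r)
erase-step (σ₂C r)   = Sum.map injC injC (erase-step r)
erase-step (ƛC r)    = Sum.map lamC lamC (erase-step r)
erase-step (starL r) = Sum.map appL appL (erase-step r)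
erase-step (starR r) = Sum.map appR appR (erase-step r)

TmM : Cx → MTy → Set
TmM Γ A = Tm Γ ⌜ A ⌝

neg-injective : ∀ {A B} → neg A ≡ neg B → A ≡ B
neg-injective {A} {B} e = trans (sym (negneg A)) (trans (cong neg e) (negneg B))

app-injective : ∀ {a c a' c'} → app a c ≡ app a' c' → a ≡ a' × c ≡ c'
app-injective refl = refl , refl

-- Inversion of erasure.  The type is only given up to an equation, since
-- `neg` is not a constructor and a term of type neg A cannot be matched directly.
erase-lam-inv : ∀ {Γ Y A b} (t : TmM Γ Y) (e : Y ≡ neg A) → erase t ≡ lam b →
                Σ (Tm (A ∷ Γ) bot) λ P → (subst (TmM Γ) e t ≡ ƛ P) × (erase P ≡ b)
erase-lam-inv (ƛ P) e refl with neg-injective e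
... | refl with e
...   | refl = P , refl , refl

erase-pair-inv : ∀ {Γ Y X₁ X₂ p₁ p₂} (t : TmM Γ Y) (e : Y ≡ X₁ ∧ X₂) →
                 erase t ≡ pair p₁ p₂ → Σ (TmM Γ X₁) λ P₁ → Σ (TmM Γ X₂) λ P₂ →
                 (subst (TmM Γ) e t ≡ ⟨ P₁ , P₂ ⟩) × (erase P₁ ≡ p₁) × (erase P₂ ≡ p₂)
erase-pair-inv ⟨ P₁ , P₂ ⟩ refl refl = P₁ , P₂ , refl , refl , refl

erase-σ₁-inv : ∀ {Γ Y X₁ X₂ q} (t : TmM Γ Y) (e : Y ≡ X₁ ∨ X₂) →
               erase t ≡ inj left q →
               Σ (TmM Γ X₁) λ Q → (subst (TmM Γ) e t ≡ σ₁ Q) × (erase Q ≡ q)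
erase-σ₁-inv (σ₁ Q) refl refl = Q , refl , refl

erase-σ₂-inv : ∀ {Γ Y X₁ X₂ q} (t : TmM Γ Y) (e : Y ≡ X₁ ∨ X₂) →
               erase t ≡ inj right q →
               Σ (TmM Γ X₂) λ Q → (subst (TmM Γ) e t ≡ σ₂ Q) × (erase Q ≡ q)
erase-σ₂-inv (σ₂ Q) refl refl = Q , refl , refl

Lifted : ∀ {Γ C} → Tm Γ C → Raw (sortOf C) → Set
Lifted {Γ} {C} t y = Σ (Tm Γ C) λ t' → (t ⟶βπ t') × (erase t' ≡ y)

lift-β : ∀ {Γ A b q} (t₁ : TmM Γ (neg A)) (t₂ : TmM Γ A) →
         erase t₁ ≡ lam b → erase t₂ ≡ q → Lifted (t₁ ⋆ t₂) (b [ q ]ʳ)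
lift-β {A = A} t₁ t₂ e₁ refl with erase-lam-inv {A = A} t₁ refl e₁
... | P , refl , refl = P [ t₂ ] , root (β P t₂) , erase-single P t₂

lift-β⊥ : ∀ {Γ A b q} (t₁ : TmM Γ (neg A)) (t₂ : TmM Γ A) →
          erase t₂ ≡ lam b → erase t₁ ≡ q → Lifted (t₁ ⋆ t₂) (b [ q ]ʳ)
lift-β⊥ t₁ (ƛ {A} P) refl refl =
  P [ castTm (negneg A) t₁ ] , root (β⊥ t₁ P) ,
  trans (erase-single P (castTm (negneg A) t₁)) (cong (erase P [_]ʳ) (erase-cast (negneg A) t₁))

lift-π : ∀ {Γ A p₁ p₂ q} i (t₁ : TmM Γ (neg A)) (t₂ : TmM Γ A) →
         erase t₁ ≡ pair p₁ p₂ → erase t₂ ≡ inj i q → Lifted (t₁ ⋆ t₂) (app (sel i p₁ p₂) q)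
lift-π left t₁ (σ₁ Q) e₁ refl with erase-pair-inv t₁ refl e₁
... | P₁ , P₂ , refl , refl , refl = P₁ ⋆ Q , root (π₁ P₁ P₂ Q) , refl
lift-π right t₁ (σ₂ Q) e₁ refl with erase-pair-inv t₁ refl e₁
... | P₁ , P₂ , refl , refl , refl = P₂ ⋆ Q , root (π₂ P₁ P₂ Q) , refl

lift-π⊥ : ∀ {Γ A p₁ p₂ q} i (t₁ : TmM Γ (neg A)) (t₂ : TmM Γ A) →
          erase t₁ ≡ inj i q → erase t₂ ≡ pair p₁ p₂ → Lifted (t₁ ⋆ t₂) (app q (sel i p₁ p₂))
lift-π⊥ left t₁ ⟨ P₁ , P₂ ⟩ e₁ refl with erase-σ₁-inv t₁ refl e₁
... | Q , refl , refl = Q ⋆ P₁ , root (π⊥₁ Q P₁ P₂) , refl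
lift-π⊥ right t₁ ⟨ P₁ , P₂ ⟩ e₁ refl with erase-σ₂-inv t₁ refl e₁
... | Q , refl , refl = Q ⋆ P₂ , root (π⊥₂ Q P₁ P₂) , refl

lift-root : ∀ {Γ A} (t₁ : TmM Γ (neg A)) (t₂ : TmM Γ A) {x y : Raw bs} →
            app (erase t₁) (erase t₂) ≡ x → x ▷βπ y → Lifted (t₁ ⋆ t₂) y
lift-root t₁ t₂ eq (β _ _)      = let e₁ , e₂ = app-injective eq in lift-β    t₁ t₂ e₁ e₂
lift-root t₁ t₂ eq (β⊥ _ _)     = let e₁ , e₂ = app-injective eq in lift-β⊥   t₁ t₂ e₂ e₁
lift-root t₁ t₂ eq (π i _ _ _)  = let e₁ , e₂ = app-injective eq in lift-π  i t₁ t₂ e₁ e₂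
lift-root t₁ t₂ eq (π⊥ i _ _ _) = let e₁ , e₂ = app-injective eq in lift-π⊥ i t₁ t₂ e₁ e₂

lift-step : ∀ {Γ C} (t : Tm Γ C) {y} → erase t ⇒βπ y → Lifted t y
lift-step (var _)   (root ())
lift-step (P ⋆ Q)   (root r)  = lift-root P Q refl r
lift-step ⟨ P , Q ⟩ (pairL r) =
  let P' , r' , e = lift-step P r in ⟨ P' , Q ⟩ , pairL r' , cong (λ z → pair z (erase Q)) e
lift-step ⟨ P , Q ⟩ (pairR r) =
  let Q' , r' , e = lift-step Q r in ⟨ P , Q' ⟩ , pairR r' , cong (pair (erase P)) e
lift-step (σ₁ P)    (injC r)  =
  let P' , r' , e = lift-step P r in σ₁ P' , σ₁C r' , cong (inj left) e
lift-step (σ₂ P)    (injC r)  =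
  let P' , r' , e = lift-step P r in σ₂ P' , σ₂C r' , cong (inj right) e
lift-step (ƛ P)     (lamC r)  =
  let P' , r' , e = lift-step P r in ƛ P' , ƛC r' , cong lam e
lift-step (P ⋆ Q)   (appL r)  =
  let P' , r' , e = lift-step P r in P' ⋆ Q , starL r' , cong (λ z → app z (erase Q)) e
lift-step (P ⋆ Q)   (appR r)  =
  let Q' , r' , e = lift-step Q r in P ⋆ Q' , starR r' , cong (app (erase P)) e

erase-SN : ∀ {Γ C} (t : Tm Γ C) → SN _⟶βπ_ t → SN-raw (erase t)
erase-SN t (acc rec) = acc λ r →
  let t' , r' , e = lift-step t r in subst SN-raw e (erase-SN t' (rec r'))

-- A typed term u whose erasure lies below a term x that is SNsub is strongly
-- normalising: by induction on SNsub x for βπ-steps (simulated by x) and on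
-- the size of erase u for deletions (which keep it below x).
sn-below : ∀ {Γ C} {x : Raw (sortOf C)} → SNsub x → (u : Tm Γ C) → x ⊒ erase u →
           Acc _<_ (size (erase u)) → SN _⟶_ u
sn-below (sn reducts subterms) u d (acc smaller) = acc λ {v} r →
  Sum.[ (λ rβπ  → let _ , rs , d' = simulate (sn reducts subterms) d rβπ
                  in sn-below (reducts rs) v d' (<-wellFounded _))
      , (λ rdel → sn-below (sn reducts subterms) v (⊒-del d rdel) (smaller (del-size rdel)))
      ]′ (erase-step r)

corollary1p21 : (∀ (Γ : Cx) (C : Ty) (t : Tm Γ C) → SN _⟶βπ_ t) →
                ∀ (Γ : Cx) (C : Ty) (t : Tm Γ C) → SN _⟶_ t
corollary1p21 SNβπ Γ C t = sn-below (SN⇒SNsub (erase-SN t (SNβπ Γ C t))) t rfl (<-wellFounded _)
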